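{- Let $M$ be a matroid, let $k \ge 0$ be an integer, and let $\mathcal{C}$ be a collection of circuits of $M$ such that, for some $J\subseteq E(M)$ with $|J|\le k$, we have $C\cap C' = J$ for all distinct $C,C'\in\mathcal{C}$. Then for every subcollection $\{C_1,\dots,C_{2^k}\}\subseteq \mathcal{C}$ of $2^k$ distinct circuits, there is a circuit of $M$ contained in $\bigcup_{i=1}^{2^k} C_i - J$. -}

module Defs where

open import Data.Nat using (ℕ)
open import Data.Fin using (Fin)
open import Data.Fin.Subset using (Subset; _∈_; _⊆_; _∪_; _-_; ⊥)
open import Data.Product using (∃; _×_)
open import Relation.Nullary using (¬_)
open import Relation.Binary.PropositionalEquality using (_≡_; _≢_)

record Matroid (n : ℕ) : Set₁ where
  field
    IsCircuit : Subset n → Set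
    circuit-nonempty : ¬ IsCircuit ⊥
    circuit-incomparable : ∀ {C D} → IsCircuit C → IsCircuit D → C ⊆ D → C ≡ D
    circuit-elim : ∀ {C D e} → IsCircuit C → IsCircuit D → C ≢ D →
                   e ∈ C → e ∈ D → ∃ λ F → IsCircuit F × F ⊆ ((C ∪ D) - e)

module Submission where

-- Call J circuit-free if it contains no circuit.
-- The core statement is `circuit-outside`: if 2^k circuits lie in U, pairwise
-- meet inside a circuit-free set J, and |J| ≤ k, then some circuit lies in U ─ J.
-- It is proved by induction on k.  If J is empty any member works.  Otherwise
-- pick e ∈ J and split the family into 2^(k-1) pairs.  The two members of a pair
-- are distinct (equal members would be a circuit inside J), so circuit
-- elimination yields a circuit inside their union avoiding e (`eliminate`).
-- The resulting 2^(k-1) circuits lie in U - e and pairwise meet inside J - e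
-- (`halve`), and |J - e| ≤ k - 1, so the induction hypothesis applies.
-- The theorem follows: in the paper's situation J is circuit-free because it is
-- empty (k = 0) or the intersection of two distinct circuits
-- (`sharedCore-circuitFree`), and the union of the family plays the role of U.

open import Defs
open import Data.Nat using (ℕ; zero; suc; _≤_; _^_; s≤s⁻¹)
open import Data.Nat.Properties using (≤-trans; m^n>0)
open import Data.Fin using (Fin; zero; suc; fromℕ<; combine; remQuot)
open import Data.Fin.Properties using (remQuot-combine)
open import Data.Fin.Subset
  using (Subset; _⊆_; _∩_; _∪_; _─_; _-_; ⋃; ∣_∣; _∈_; _∉_; ⁅_⁆; Empty; inside)
open import Data.Fin.Subset.Properties
  using ( _∈?_; nonempty?; Empty-unique; x∈⁅x⁆; x∈p∩q⁺; x∈p∩q⁻; x∈p∪q⁻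
        ; p⊆p∪q; q⊆p∪q; p─q⊆p; x∈p∧x∉q⇒x∈p─q; x∈p∧x≢y⇒x∈p-y; x∈p⇒∣p-x∣<∣p∣ )
open import Data.Vec.Base using (_∷_; here; there)
open import Data.List using (tabulate)
open import Data.Product using (∃; _×_; _,_; proj₁; proj₂; uncurry)
open import Data.Sum using (inj₁; inj₂)
open import Function using (_∘_)
open import Function.Definitions using (Injective)
open import Relation.Nullary using (¬_; yes; no; contradiction)
open import Relation.Binary.PropositionalEquality
  using (_≡_; _≢_; refl; sym; trans; cong; subst)

x∈p─q⇒x∉q : ∀ {n} {x : Fin n} (p q : Subset n) → x ∈ p ─ q → x ∉ q
x∈p─q⇒x∉q (_ ∷ p) (inside ∷ q) () here
x∈p─q⇒x∉q (_ ∷ p) (_ ∷ q) (there x∈p─q) (there x∈q) = x∈p─q⇒x∉q p q x∈p─q x∈q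

x∈p-y⇒x≢y : ∀ {n} {x y : Fin n} (p : Subset n) → x ∈ p - y → x ≢ y
x∈p-y⇒x≢y {y = y} p x∈p-y refl = x∈p─q⇒x∉q p ⁅ y ⁆ x∈p-y (x∈⁅x⁆ y)

p-x─q-x⊆p─q : ∀ {n} (p q : Subset n) x → (p - x) ─ (q - x) ⊆ p ─ q
p-x─q-x⊆p─q p q x {y} y∈ = x∈p∧x∉q⇒x∈p─q (p─q⊆p p ⁅ x ⁆ y∈p-x) y∉q
  where
  y∈p-x : y ∈ p - x
  y∈p-x = p─q⊆p (p - x) (q - x) y∈
  y∉q : y ∉ q
  y∉q y∈q = x∈p─q⇒x∉q (p - x) (q - x) y∈ (x∈p∧x≢y⇒x∈p-y y∈q (x∈p-y⇒x≢y p y∈p-x))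

∣p∣≤0⇒Empty : ∀ {n} {p : Subset n} → ∣ p ∣ ≤ 0 → Empty p
∣p∣≤0⇒Empty size (x , x∈p) with ≤-trans (x∈p⇒∣p-x∣<∣p∣ x∈p) size
... | ()

⊆⋃ : ∀ {n m} (Cs : Fin m → Subset n) i → Cs i ⊆ ⋃ (tabulate Cs)
⊆⋃ Cs zero    = p⊆p∪q _
⊆⋃ Cs (suc i) = q⊆p∪q (Cs zero) _ ∘ ⊆⋃ (Cs ∘ suc) i

-- Indexing by Fin (2 ^ k): the index set is nonempty, and Fin (2 ^ suc k)
-- contains a copy of Fin 2 × Fin (2 ^ k), i.e. it splits into pairs.

someIndex : ∀ k → Fin (2 ^ k)
someIndex k = fromℕ< (m^n>0 2 k)

pairIndex : ∀ k → Fin 2 × Fin (2 ^ k) → Fin (2 ^ suc k)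
pairIndex k = uncurry combine

pairIndex-injective : ∀ k → Injective _≡_ _≡_ (pairIndex k)
pairIndex-injective k {b , i} {c , j} eq =
  trans (sym (remQuot-combine b i)) (trans (cong (remQuot (2 ^ k)) eq) (remQuot-combine c j))

module _ {n : ℕ} (M : Matroid n) where
  open Matroid M

  CircuitFree : Subset n → Set
  CircuitFree J = ∀ {F} → IsCircuit F → ¬ F ⊆ J

  circuitFree-⊆ : ∀ {J J′} → J′ ⊆ J → CircuitFree J → CircuitFree J′
  circuitFree-⊆ J′⊆J free cF F⊆J′ = free cF (J′⊆J ∘ F⊆J′)

  empty-circuitFree : ∀ {J} → Empty J → CircuitFree J
  empty-circuitFree J∅ cF F⊆J =
    circuit-nonempty (subst IsCircuit (Empty-unique (λ (x , x∈F) → J∅ (x , F⊆J x∈F))) cF)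

  -- By (C2), the intersection of two distinct circuits is circuit-free: a circuit
  -- inside it would equal both of them.
  ∩-circuitFree : ∀ {C D} → IsCircuit C → IsCircuit D → C ≢ D → CircuitFree (C ∩ D)
  ∩-circuitFree {C} {D} cC cD C≢D cF F⊆C∩D = C≢D (trans (sym F≡C) F≡D)
    where
    F≡C = circuit-incomparable cF cC (proj₁ ∘ x∈p∩q⁻ C D ∘ F⊆C∩D)
    F≡D = circuit-incomparable cF cD (proj₂ ∘ x∈p∩q⁻ C D ∘ F⊆C∩D)

  -- Elimination of an arbitrary element: the union of two distinct circuits minus
  -- any e contains a circuit.  If e misses one circuit, that circuit works;
  -- otherwise this is (C3).
  eliminate : ∀ {C D} → IsCircuit C → IsCircuit D → C ≢ D → ∀ e →
              ∃ λ F → IsCircuit F × F ⊆ (C ∪ D) - e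
  eliminate {C} {D} cC cD C≢D e with e ∈? C | e ∈? D
  ... | yes e∈C | yes e∈D = circuit-elim cC cD C≢D e∈C e∈D
  ... | no e∉C  | _       =
    C , cC , λ x∈C → x∈p∧x≢y⇒x∈p-y (p⊆p∪q D x∈C) λ { refl → e∉C x∈C }
  ... | yes _   | no e∉D  =
    D , cD , λ x∈D → x∈p∧x≢y⇒x∈p-y (q⊆p∪q C D x∈D) λ { refl → e∉D x∈D }

  record Family (I : Set) (U J : Subset n) : Set where
    field
      member    : I → Subset n
      circuit   : ∀ i → IsCircuit (member i)
      contained : ∀ i → member i ⊆ U
      meet      : ∀ i j → i ≢ j → member i ∩ member j ⊆ J

  reindex : ∀ {I I′ U J} (f : I′ → I) → Injective _≡_ _≡_ f → Family I U J → Family I′ U J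
  reindex f f-inj 𝒟 = record
    { member    = member ∘ f
    ; circuit   = circuit ∘ f
    ; contained = contained ∘ f
    ; meet      = λ i j i≢j → meet (f i) (f j) (i≢j ∘ f-inj)
    }
    where open Family 𝒟

  halve : ∀ {I U J} (e : Fin n) → CircuitFree J → Family (Fin 2 × I) U J → Family I (U - e) (J - e)
  halve {J = J} e free 𝒟 = record
    { member    = proj₁ ∘ eliminated
    ; circuit   = proj₁ ∘ proj₂ ∘ eliminated
    ; contained = λ i x∈ → x∈p∧x≢y⇒x∈p-y (contained _ (proj₂ (fromPair x∈))) (avoids-e x∈)
    ; meet      = meet′
    }
    where
    open Family 𝒟

    -- Equal members of a pair would form a circuit inside J.
    pair-distinct : ∀ i → member (zero , i) ≢ member (suc zero , i)
    pair-distinct i eq =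
      free (circuit (zero , i)) (λ x∈ → meet _ _ (λ ()) (x∈p∩q⁺ (x∈ , subst (_ ∈_) eq x∈)))

    eliminated : ∀ i → ∃ λ F → IsCircuit F × F ⊆ (member (zero , i) ∪ member (suc zero , i)) - e
    eliminated i = eliminate (circuit _) (circuit _) (pair-distinct i) e

    avoids-e : ∀ {i x} → x ∈ proj₁ (eliminated i) → x ≢ e
    avoids-e {i} x∈ = x∈p-y⇒x≢y _ (proj₂ (proj₂ (eliminated i)) x∈)

    fromPair : ∀ {i x} → x ∈ proj₁ (eliminated i) → ∃ λ b → x ∈ member (b , i)
    fromPair {i} x∈ with x∈p∪q⁻ _ _ (p─q⊆p _ _ (proj₂ (proj₂ (eliminated i)) x∈))
    ... | inj₁ x∈₀ = zero , x∈₀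
    ... | inj₂ x∈₁ = suc zero , x∈₁

    -- Members of different pairs are different members of 𝒟.
    meet′ : ∀ i j → i ≢ j → proj₁ (eliminated i) ∩ proj₁ (eliminated j) ⊆ J - e
    meet′ i j i≢j x∈ with x∈p∩q⁻ _ _ x∈
    ... | x∈i , x∈j with fromPair x∈i | fromPair x∈j
    ... | b , x∈b | c , x∈c =
      x∈p∧x≢y⇒x∈p-y (meet (b , i) (c , j) (i≢j ∘ cong proj₂) (x∈p∩q⁺ (x∈b , x∈c))) (avoids-e x∈i)

  circuit-outside : ∀ k {U J} → ∣ J ∣ ≤ k → CircuitFree J → Family (Fin (2 ^ k)) U J →
                    ∃ λ F → IsCircuit F × F ⊆ U ─ J
  circuit-outside k {J = J} size free 𝒟 with nonempty? J
  ... | no J∅ = member i , circuit i , λ x∈ → x∈p∧x∉q⇒x∈p─q (contained i x∈) (λ x∈J → J∅ (_ , x∈J))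
    where
    open Family 𝒟
    i = someIndex k
  circuit-outside zero    size free 𝒟 | yes (e , e∈J) = contradiction (e , e∈J) (∣p∣≤0⇒Empty size)
  circuit-outside (suc k) {U} {J} size free 𝒟 | yes (e , e∈J)
    with circuit-outside k (s≤s⁻¹ (≤-trans (x∈p⇒∣p-x∣<∣p∣ e∈J) size))
           (circuitFree-⊆ (p─q⊆p J ⁅ e ⁆) free)
           (halve e free (reindex (pairIndex k) (pairIndex-injective k) 𝒟))
  ... | F , cF , F⊆ = F , cF , p-x─q-x⊆p─q U J e ∘ F⊆

  -- The common intersection J of 2 ^ k distinct circuits with |J| ≤ k is
  -- circuit-free: it is empty if k = 0 and the meet of two of them otherwise.
  sharedCore-circuitFree : ∀ k {J} → ∣ J ∣ ≤ k → (Cs : Fin (2 ^ k) → Subset n) →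
                           Injective _≡_ _≡_ Cs → (∀ i → IsCircuit (Cs i)) →
                           (∀ i j → i ≢ j → Cs i ∩ Cs j ≡ J) → CircuitFree J
  sharedCore-circuitFree zero    size _  _   _    _    = empty-circuitFree (∣p∣≤0⇒Empty size)
  sharedCore-circuitFree (suc k) size Cs inj circ core =
    subst CircuitFree (core a b a≢b) (∩-circuitFree (circ a) (circ b) (a≢b ∘ inj))
    where
    a = pairIndex k (zero , someIndex k)
    b = pairIndex k (suc zero , someIndex k)
    a≢b : a ≢ b
    a≢b eq with pairIndex-injective k {zero , someIndex k} {suc zero , someIndex k} eq
    ... | ()

lemma3p1 : ∀ {n} (M : Matroid n) (k : ℕ) (𝒞 : Subset n → Set) →
           (∀ C → 𝒞 C → Matroid.IsCircuit M C) →
           (J : Subset n) → ∣ J ∣ ≤ k →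
           (∀ C C′ → 𝒞 C → 𝒞 C′ → C ≢ C′ → C ∩ C′ ≡ J) →
           (Cs : Fin (2 ^ k) → Subset n) → Injective _≡_ _≡_ Cs → (∀ i → 𝒞 (Cs i)) →
           ∃ λ F → Matroid.IsCircuit M F × F ⊆ (⋃ (tabulate Cs) ─ J)
lemma3p1 M k 𝒞 circuits J size sunflower Cs inj Cs∈𝒞 =
  circuit-outside M k size (sharedCore-circuitFree M k size Cs inj circ core) family
  where
  circ : ∀ i → Matroid.IsCircuit M (Cs i)
  circ i = circuits (Cs i) (Cs∈𝒞 i)

  core : ∀ i j → i ≢ j → Cs i ∩ Cs j ≡ J
  core i j i≢j = sunflower (Cs i) (Cs j) (Cs∈𝒞 i) (Cs∈𝒞 j) (i≢j ∘ inj)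

  family : Family M (Fin (2 ^ k)) (⋃ (tabulate Cs)) J
  family = record
    { member    = Cs
    ; circuit   = circ
    ; contained = ⊆⋃ Cs
    ; meet      = λ i j i≢j → subst (_ ∈_) (core i j i≢j)
    }
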